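{- Let $x>0$ be an integer that is not a power of $2$. Then there is an integer $y>0$ with $\mathbf{m}(y)=0$ and $\mathbf{m}(xy)=1$.
   Context: $\mathbf{m}$ is the Thue--Morse sequence: $\mathbf{m}(n)\in\{0,1\}$ is the parity of the number of $1$s in the binary expansion of $n$. -}

module Defs where

open import Data.Nat using (ℕ; zero; suc; _+_; _*_; _^_; _/_; _%_)
open import Data.Product using (Σ)
open import Relation.Binary.PropositionalEquality using (_≡_)

-- Number of 1s in the binary expansion of n, computed with fuel.
-- With fuel ≥ n the result is exact (each step halves n, and n / 2 < n for n > 0).
popcountFuel : ℕ → ℕ → ℕ
popcountFuel zero    n = 0
popcountFuel (suc f) zero = 0
popcountFuel (suc f) n@(suc _) = n % 2 + popcountFuel f (n / 2)

popcount : ℕ → ℕ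
popcount n = popcountFuel n n

m : ℕ → ℕ
m n = popcount n % 2

IsPowerOf2 : ℕ → Set
IsPowerOf2 x = Σ ℕ (λ k → 2 ^ k ≡ x)

module Submission where

-- Write ν(n) for the number of binary ones of n, so m(n) = ν(n) mod 2.
-- Three facts about ν drive the proof:
--   * concatenation:  ν(a + 2^K b) = ν(a) + ν(b) whenever a < 2^K;
--   * complements:    ν(c) + ν(d) = k whenever c + d = 2^k - 1;
--   * blocks of ones: ν(x (2^k - 1)) = k whenever 1 <= x <= 2^k.
-- Call z a parity changer for x when m(xz) /= m(z).  A changer yields the
-- theorem: either z itself is the required y, or y = z + 2^M (2^k - 1) with
-- k odd and M large, which flips both m(y) and m(xy).  A changer for x is one
-- for 2x, and for odd x = 2^K + r with 0 < r < 2^K we exhibit one directly: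
--   * x = 1 (mod 4): z = 2^K + 1 has two ones while ν(xz) is odd;
--   * x = 3 (mod 4): z = 2^K - 1 has K ones while ν(xz) = K + 1.
-- Strong induction on x then gives a changer for every x that is not a
-- power of 2, and hence the theorem.

open import Defs
open import Data.Nat
open import Data.Nat.Properties
open import Data.Nat.DivMod
open import Data.Nat.Induction using (<-rec)
open import Data.Nat.Tactic.RingSolver using (solve-∀)
open import Data.Product using (Σ; _×_; _,_)
open import Data.Sum using (_⊎_; inj₁; inj₂)
open import Data.Empty using (⊥-elim)
open import Relation.Binary.PropositionalEquality
open import Relation.Nullary using (¬_; yes; no)

data Halving : ℕ → Set where
  even : ∀ q → Halving (q * 2)
  odd  : ∀ q → Halving (1 + q * 2)

halving : ∀ n → Halving n
halving zero = even 0
halving (suc n) with halving n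
... | even q = odd q
... | odd q  = even (suc q)

even-mod2 : ∀ q → q * 2 % 2 ≡ 0
even-mod2 q = m*n%n≡0 q 2

odd-mod2 : ∀ q → (1 + q * 2) % 2 ≡ 1
odd-mod2 q = [m+kn]%n≡m%n 1 q 2

odd-div2 : ∀ q → (1 + q * 2) / 2 ≡ q
odd-div2 q = trans (+-distrib-/ 1 (q * 2) last-digits<2) (m*n/n≡m q 2)
  where
    last-digits<2 : 1 % 2 + q * 2 % 2 < 2
    last-digits<2 = subst (λ t → 1 + t < 2) (sym (even-mod2 q)) ≤-refl

odd≢even : ∀ a b → 1 + a * 2 ≢ b * 2
odd≢even zero    zero    ()
odd≢even zero    (suc b) ()
odd≢even (suc a) zero    ()
odd≢even (suc a) (suc b) eq = odd≢even a b (suc-injective (suc-injective eq))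

odd-injective : ∀ a b → 1 + a * 2 ≡ 1 + b * 2 → a ≡ b
odd-injective a b eq = *-cancelʳ-≡ a b 2 (suc-injective eq)

parity-suc : ∀ n → suc n % 2 ≢ n % 2
parity-suc n with halving n
... | even q = λ eq → 1+n≢0 (trans (sym (odd-mod2 q)) (trans eq (even-mod2 q)))
... | odd q  = λ eq → 0≢1+n (trans (sym (even-mod2 (suc q))) (trans eq (odd-mod2 q)))

popcountFuel-0 : ∀ f → popcountFuel f 0 ≡ 0
popcountFuel-0 zero    = refl
popcountFuel-0 (suc f) = refl

popcountFuel-stable : ∀ f g n → n ≤ f → n ≤ g → popcountFuel f n ≡ popcountFuel g n
popcountFuel-stable f g zero _ _ = trans (popcountFuel-0 f) (sym (popcountFuel-0 g))
popcountFuel-stable zero    g       (suc _) () _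
popcountFuel-stable (suc f) zero    (suc _) _  ()
popcountFuel-stable (suc f) (suc g) n@(suc n′) (s≤s n′≤f) (s≤s n′≤g) =
  cong (n % 2 +_) (popcountFuel-stable f g (n / 2) (≤-trans half≤n′ n′≤f) (≤-trans half≤n′ n′≤g))
  where
    half≤n′ : n / 2 ≤ n′
    half≤n′ = <⇒≤pred (m/n<m n 2 (s≤s (s≤s z≤n)))

popcount-even : ∀ q → popcount (q * 2) ≡ popcount q
popcount-even zero = refl
popcount-even q@(suc q′) = begin
    q * 2 % 2 + popcountFuel (suc (q′ * 2)) (q * 2 / 2)
  ≡⟨ cong₂ _+_ (even-mod2 q) (cong (popcountFuel (suc (q′ * 2))) (m*n/n≡m q 2)) ⟩
    popcountFuel (suc (q′ * 2)) q
  ≡⟨ popcountFuel-stable _ _ q (s≤s (m≤m*n q′ 2)) ≤-refl ⟩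
    popcount q ∎
  where open ≡-Reasoning

popcount-odd : ∀ q → popcount (1 + q * 2) ≡ suc (popcount q)
popcount-odd q = begin
    (1 + q * 2) % 2 + popcountFuel (q * 2) ((1 + q * 2) / 2)
  ≡⟨ cong₂ _+_ (odd-mod2 q) (cong (popcountFuel (q * 2)) (odd-div2 q)) ⟩
    suc (popcountFuel (q * 2) q)
  ≡⟨ cong suc (popcountFuel-stable _ _ q (m≤m*n q 2) ≤-refl) ⟩
    suc (popcount q) ∎
  where open ≡-Reasoning

popcount-concat : ∀ K a b → a < 2 ^ K → popcount (a + 2 ^ K * b) ≡ popcount a + popcount b
popcount-concat zero zero b _ = cong popcount (+-identityʳ b)
popcount-concat zero (suc a) b (s≤s ())
popcount-concat (suc K) a b a<2P with halving a
... | even q = begin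
    popcount (q * 2 + 2 ^ suc K * b)  ≡⟨ cong popcount (shift-even q (2 ^ K) b) ⟩
    popcount ((q + 2 ^ K * b) * 2)    ≡⟨ popcount-even (q + 2 ^ K * b) ⟩
    popcount (q + 2 ^ K * b)          ≡⟨ popcount-concat K q b (half< q a<2P) ⟩
    popcount q + popcount b           ≡⟨ cong (_+ popcount b) (sym (popcount-even q)) ⟩
    popcount (q * 2) + popcount b     ∎
  where
    open ≡-Reasoning
    shift-even : ∀ q P b → q * 2 + (2 * P) * b ≡ (q + P * b) * 2
    shift-even = solve-∀
    half< : ∀ q → q * 2 < 2 ^ suc K → q < 2 ^ K
    half< q h = *-cancelʳ-< 2 q (2 ^ K) (subst (q * 2 <_) (*-comm 2 (2 ^ K)) h)
... | odd q = begin
    popcount (1 + q * 2 + 2 ^ suc K * b)  ≡⟨ cong popcount (shift-odd q (2 ^ K) b) ⟩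
    popcount (1 + (q + 2 ^ K * b) * 2)    ≡⟨ popcount-odd (q + 2 ^ K * b) ⟩
    suc (popcount (q + 2 ^ K * b))        ≡⟨ cong suc (popcount-concat K q b (half< q a<2P)) ⟩
    suc (popcount q + popcount b)         ≡⟨ cong (_+ popcount b) (sym (popcount-odd q)) ⟩
    popcount (1 + q * 2) + popcount b     ∎
  where
    open ≡-Reasoning
    shift-odd : ∀ q P b → 1 + q * 2 + (2 * P) * b ≡ 1 + (q + P * b) * 2
    shift-odd = solve-∀
    half< : ∀ q → 1 + q * 2 < 2 ^ suc K → q < 2 ^ K
    half< q h = *-cancelʳ-< 2 q (2 ^ K) (subst (q * 2 <_) (*-comm 2 (2 ^ K)) (<-trans (n<1+n _) h))

allOnes : ℕ → ℕ
allOnes zero    = 0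
allOnes (suc k) = 1 + allOnes k * 2

2^k≡1+allOnes : ∀ k → 2 ^ k ≡ suc (allOnes k)
2^k≡1+allOnes zero    = refl
2^k≡1+allOnes (suc k) = begin
    2 * 2 ^ k               ≡⟨ cong (2 *_) (2^k≡1+allOnes k) ⟩
    2 * suc (allOnes k)     ≡⟨ *-comm 2 (suc (allOnes k)) ⟩
    suc (allOnes k) * 2     ∎
  where open ≡-Reasoning

popcount-allOnes : ∀ k → popcount (allOnes k) ≡ k
popcount-allOnes zero    = refl
popcount-allOnes (suc k) = trans (popcount-odd (allOnes k)) (cong suc (popcount-allOnes k))

popcount-complement : ∀ k c d → c + d ≡ allOnes k → popcount c + popcount d ≡ k
popcount-complement zero c d c+d≡0
  rewrite m+n≡0⇒m≡0 c c+d≡0 | m+n≡0⇒n≡0 c c+d≡0 = refl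
popcount-complement (suc k) c d eq with halving c | halving d
... | even q | even q′ = ⊥-elim (odd≢even (allOnes k) (q + q′) (sym (trans (sym (sum-even q q′)) eq)))
  where
    sum-even : ∀ q q′ → q * 2 + q′ * 2 ≡ (q + q′) * 2
    sum-even = solve-∀
... | odd q | odd q′ = ⊥-elim (odd≢even (allOnes k) (suc (q + q′)) (sym (trans (sym (sum-odd q q′)) eq)))
  where
    sum-odd : ∀ q q′ → 1 + q * 2 + (1 + q′ * 2) ≡ (1 + (q + q′)) * 2
    sum-odd = solve-∀
... | even q | odd q′ = begin
    popcount (q * 2) + popcount (1 + q′ * 2)  ≡⟨ cong₂ _+_ (popcount-even q) (popcount-odd q′) ⟩
    popcount q + suc (popcount q′)            ≡⟨ +-suc (popcount q) (popcount q′) ⟩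
    suc (popcount q + popcount q′)            ≡⟨ cong suc (popcount-complement k q q′ halves) ⟩
    suc k                                     ∎
  where
    open ≡-Reasoning
    sum : ∀ q q′ → q * 2 + (1 + q′ * 2) ≡ 1 + (q + q′) * 2
    sum = solve-∀
    halves : q + q′ ≡ allOnes k
    halves = odd-injective (q + q′) (allOnes k) (trans (sym (sum q q′)) eq)
... | odd q | even q′ = begin
    popcount (1 + q * 2) + popcount (q′ * 2)  ≡⟨ cong₂ _+_ (popcount-odd q) (popcount-even q′) ⟩
    suc (popcount q + popcount q′)            ≡⟨ cong suc (popcount-complement k q q′ halves) ⟩
    suc k                                     ∎
  where
    open ≡-Reasoning
    sum : ∀ q q′ → 1 + q * 2 + q′ * 2 ≡ 1 + (q + q′) * 2
    sum = solve-∀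
    halves : q + q′ ≡ allOnes k
    halves = odd-injective (q + q′) (allOnes k) (trans (sym (sum q q′)) eq)

-- The complement of c below 2^k, in the form the applications produce it.
complement-below : ∀ k c d → d + suc c ≡ 2 ^ k → c + d ≡ allOnes k
complement-below k c d eq = suc-injective (begin
    suc (c + d)      ≡⟨ cong suc (+-comm c d) ⟩
    suc (d + c)      ≡⟨ sym (+-suc d c) ⟩
    d + suc c        ≡⟨ eq ⟩
    2 ^ k            ≡⟨ 2^k≡1+allOnes k ⟩
    suc (allOnes k)  ∎)
  where open ≡-Reasoning

below-sum : ∀ {d c P} → d + suc c ≡ P → d < P
below-sum {d} eq = <-≤-trans (m<m+n d (s≤s z≤n)) (≤-reflexive eq)

times-allOnes : ∀ k s e d → d + (s + e) ≡ s * 2 ^ k → (s + e) * allOnes k ≡ d + 2 ^ k * e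
times-allOnes k s e d eq = +-cancelʳ-≡ (s + e) _ _ (begin
    (s + e) * allOnes k + (s + e)  ≡⟨ +-comm _ (s + e) ⟩
    (s + e) + (s + e) * allOnes k  ≡⟨ sym (*-suc (s + e) (allOnes k)) ⟩
    (s + e) * suc (allOnes k)      ≡⟨ cong ((s + e) *_) (sym (2^k≡1+allOnes k)) ⟩
    (s + e) * 2 ^ k                ≡⟨ split s e (2 ^ k) ⟩
    s * 2 ^ k + 2 ^ k * e          ≡⟨ cong (_+ 2 ^ k * e) (sym eq) ⟩
    d + (s + e) + 2 ^ k * e        ≡⟨ regroup d (s + e) (2 ^ k * e) ⟩
    d + 2 ^ k * e + (s + e)        ∎)
  where
    open ≡-Reasoning
    split : ∀ s e P → (s + e) * P ≡ s * P + P * e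
    split = solve-∀
    regroup : ∀ a b c → a + b + c ≡ a + c + b
    regroup = solve-∀

popcount-block : ∀ k x → 0 < x → x ≤ 2 ^ k → popcount (x * allOnes k) ≡ k
popcount-block k (suc e) _ x≤2^k = begin
    popcount ((1 + e) * allOnes k)  ≡⟨ cong popcount (times-allOnes k 1 e d fill) ⟩
    popcount (d + 2 ^ k * e)        ≡⟨ popcount-concat k d e (below-sum d+x) ⟩
    popcount d + popcount e         ≡⟨ +-comm (popcount d) (popcount e) ⟩
    popcount e + popcount d         ≡⟨ popcount-complement k e d (complement-below k e d d+x) ⟩
    k                               ∎
  where
    open ≡-Reasoning
    d : ℕ
    d = 2 ^ k ∸ suc e
    d+x : d + suc e ≡ 2 ^ k
    d+x = m∸n+n≡m x≤2^k
    fill : d + (1 + e) ≡ 1 * 2 ^ k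
    fill = trans d+x (sym (*-identityˡ (2 ^ k)))

n<2^n : ∀ n → n < 2 ^ n
n<2^n zero    = s≤s z≤n
n<2^n (suc n) = begin-strict
    suc n          ≤⟨ n<2^n n ⟩
    2 ^ n          <⟨ m<m+n (2 ^ n) (m^n>0 2 n) ⟩
    2 ^ n + 2 ^ n  ≡⟨ cong (2 ^ n +_) (sym (+-identityʳ (2 ^ n))) ⟩
    2 ^ suc n      ∎
  where open ≤-Reasoning

leading-bit : ∀ x → 0 < x → Σ ℕ λ K → Σ ℕ λ r → r < 2 ^ K × x ≡ 2 ^ K + r
leading-bit x x>0 = below x (n<2^n x)
  where
    below : ∀ n → x < 2 ^ n → Σ ℕ λ K → Σ ℕ λ r → r < 2 ^ K × x ≡ 2 ^ K + r
    below zero x<1 = ⊥-elim (<-irrefl refl (<-≤-trans x>0 (≤-pred x<1)))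
    below (suc K) x<2P with x <? 2 ^ K
    ... | yes x<P = below K x<P
    ... | no x≮P  = K , x ∸ 2 ^ K , r<P , sym P+r≡x
      where
        open ≤-Reasoning
        P+r≡x : 2 ^ K + (x ∸ 2 ^ K) ≡ x
        P+r≡x = m+[n∸m]≡n (≮⇒≥ x≮P)
        r<P : x ∸ 2 ^ K < 2 ^ K
        r<P = +-cancelˡ-< (2 ^ K) _ _ (begin-strict
          2 ^ K + (x ∸ 2 ^ K)  ≡⟨ P+r≡x ⟩
          x                    <⟨ x<2P ⟩
          2 ^ suc K            ≡⟨ cong (2 ^ K +_) (+-identityʳ (2 ^ K)) ⟩
          2 ^ K + 2 ^ K        ∎)

m-values : ∀ n → m n ≡ 0 ⊎ m n ≡ 1
m-values n with popcount n % 2 | m%n<n (popcount n) 2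
... | 0 | _ = inj₁ refl
... | 1 | _ = inj₂ refl
... | suc (suc _) | s≤s (s≤s ())

m-concat : ∀ K a b → a < 2 ^ K → m (a + 2 ^ K * b) ≡ (m a + m b) % 2
m-concat K a b a< =
  trans (cong (_% 2) (popcount-concat K a b a<)) (%-distribˡ-+ (popcount a) (popcount b) 2)

m-suc : ∀ a b → popcount a ≡ suc (popcount b) → m a ≢ m b
m-suc a b eq = subst (λ t → t % 2 ≢ m b) (sym eq) (parity-suc (popcount b))

ParityChanger : ℕ → ℕ → Set
ParityChanger x z = m (x * z) ≢ m z

TMWitness : ℕ → Set
TMWitness x = Σ ℕ (λ y → 0 < y × m y ≡ 0 × m (x * y) ≡ 1)

changer-positive : ∀ x z → ParityChanger x z → 0 < z
changer-positive x zero    ch = ⊥-elim (ch (cong m (*-zeroʳ x)))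
changer-positive x (suc z) ch = s≤s z≤n

-- A changer gives a witness: if m(z) = 1 and m(xz) = 0, write an odd block
-- of ones to the left of z; by the block lemma it adds an odd number of ones
-- to both z and xz.
witness-from-changer : ∀ x z → 0 < x → ParityChanger x z → TMWitness x
witness-from-changer x z x>0 ch with m-values z | m-values (x * z)
... | inj₁ mz≡0 | inj₁ mxz≡0 = ⊥-elim (ch (trans mxz≡0 (sym mz≡0)))
... | inj₂ mz≡1 | inj₂ mxz≡1 = ⊥-elim (ch (trans mxz≡1 (sym mz≡1)))
... | inj₁ mz≡0 | inj₂ mxz≡1 = z , changer-positive x z ch , mz≡0 , mxz≡1
... | inj₂ mz≡1 | inj₁ mxz≡0 = z + 2 ^ M * w , y>0 , my≡0 , mxy≡1
  where
    open ≡-Reasoning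
    k M w : ℕ
    k = 1 + x * 2
    M = x * z + z
    w = allOnes k
    y>0 : 0 < z + 2 ^ M * w
    y>0 = ≤-trans (changer-positive x z ch) (m≤m+n z _)
    x≤2^k : x ≤ 2 ^ k
    x≤2^k = <⇒≤ (<-≤-trans (n<2^n x) (^-monoʳ-≤ 2 (≤-trans (m≤m*n x 2) (n≤1+n _))))
    m-w : m w ≡ 1
    m-w = trans (cong (_% 2) (popcount-allOnes k)) (odd-mod2 x)
    m-xw : m (x * w) ≡ 1
    m-xw = trans (cong (_% 2) (popcount-block k x x>0 x≤2^k)) (odd-mod2 x)
    distribute : ∀ x z P w → x * (z + P * w) ≡ x * z + P * (x * w)
    distribute = solve-∀
    my≡0 : m (z + 2 ^ M * w) ≡ 0
    my≡0 = begin
      m (z + 2 ^ M * w)  ≡⟨ m-concat M z w (≤-<-trans (m≤n+m z (x * z)) (n<2^n M)) ⟩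
      (m z + m w) % 2    ≡⟨ cong₂ (λ a b → (a + b) % 2) mz≡1 m-w ⟩
      0                  ∎
    mxy≡1 : m (x * (z + 2 ^ M * w)) ≡ 1
    mxy≡1 = begin
      m (x * (z + 2 ^ M * w))        ≡⟨ cong m (distribute x z (2 ^ M) w) ⟩
      m (x * z + 2 ^ M * (x * w))    ≡⟨ m-concat M (x * z) (x * w) (≤-<-trans (m≤m+n (x * z) z) (n<2^n M)) ⟩
      (m (x * z) + m (x * w)) % 2    ≡⟨ cong₂ (λ a b → (a + b) % 2) mxz≡0 m-xw ⟩
      1                              ∎

-- Doubling x keeps parity changers, since ν(2n) = ν(n).
changer-double : ∀ x z → ParityChanger x z → ParityChanger (x * 2) z
changer-double x z ch eq = ch (trans (cong (_% 2) (sym ν-2xz)) eq)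
  where
    reassociate : ∀ x z → x * 2 * z ≡ x * z * 2
    reassociate = solve-∀
    ν-2xz : popcount (x * 2 * z) ≡ popcount (x * z)
    ν-2xz = trans (cong popcount (reassociate x z)) (popcount-even (x * z))

-- Odd x = 1 + 4A = 2^K + r with K ≥ 1: z = 2^K + 1 has two ones, while
-- xz = r + 2^(K+1) (1 + 2A) and ν(r) = ν(A) give ν(xz) = 2ν(A) + 1.
changer-1mod4 : ∀ A → ¬ IsPowerOf2 (1 + A * 2 * 2) → Σ ℕ (ParityChanger (1 + A * 2 * 2))
changer-1mod4 A np with leading-bit (1 + A * 2 * 2) (s≤s z≤n)
... | zero , zero , _ , x≡1 = ⊥-elim (np (0 , sym x≡1))
... | zero , suc r , s≤s () , _
... | suc K , r , r<P , x≡P+r = z , λ eq → 1+n≢0 (trans (sym m-xz≡1) (trans eq m-z≡0))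
  where
    open ≡-Reasoning
    x P z : ℕ
    x = 1 + A * 2 * 2
    P = 2 ^ suc K
    z = 1 + P * 1
    m-z≡0 : m z ≡ 0
    m-z≡0 = cong (_% 2) (popcount-concat (suc K) 1 1 (*-monoʳ-≤ 2 (m^n>0 2 K)))
    ν-r≡ν-A : popcount r ≡ popcount A
    ν-r≡ν-A = suc-injective (begin
      suc (popcount r)         ≡⟨ +-comm 1 (popcount r) ⟩
      popcount r + popcount 1  ≡⟨ sym (popcount-concat (suc K) r 1 r<P) ⟩
      popcount (r + P * 1)     ≡⟨ cong popcount (sym (trans x≡P+r (P+r≡r+P*1 P r))) ⟩
      popcount x               ≡⟨ popcount-odd (A * 2) ⟩
      suc (popcount (A * 2))   ≡⟨ cong suc (popcount-even A) ⟩
      suc (popcount A)         ∎)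
      where
        P+r≡r+P*1 : ∀ P r → P + r ≡ r + P * 1
        P+r≡r+P*1 = solve-∀
    xz≡ : x * z ≡ r + (2 * P) * (1 + A * 2)
    xz≡ = begin
      x * z                        ≡⟨ expand x P ⟩
      x + x * P                    ≡⟨ cong (_+ x * P) x≡P+r ⟩
      (P + r) + x * P              ≡⟨ collect P r A ⟩
      r + (2 * P) * (1 + A * 2)    ∎
      where
        expand : ∀ x P → x * (1 + P * 1) ≡ x + x * P
        expand = solve-∀
        collect : ∀ P r A → (P + r) + (1 + A * 2 * 2) * P ≡ r + (2 * P) * (1 + A * 2)
        collect = solve-∀
    m-xz≡1 : m (x * z) ≡ 1
    m-xz≡1 = begin
      m (x * z)                                    ≡⟨ cong m xz≡ ⟩
      popcount (r + (2 * P) * (1 + A * 2)) % 2     ≡⟨ cong (_% 2) (popcount-concat (suc (suc K)) r (1 + A * 2) (≤-trans r<P (m≤m+n P _))) ⟩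
      (popcount r + popcount (1 + A * 2)) % 2      ≡⟨ cong (_% 2) (cong₂ _+_ ν-r≡ν-A (popcount-odd A)) ⟩
      (popcount A + suc (popcount A)) % 2          ≡⟨ cong (_% 2) (double+1 (popcount A)) ⟩
      (1 + popcount A * 2) % 2                     ≡⟨ odd-mod2 (popcount A) ⟩
      1                                            ∎
      where
        double+1 : ∀ a → a + suc a ≡ 1 + a * 2
        double+1 = solve-∀

-- Odd x = 3 + 4A = 2^K + r with r ≥ 1: z = 2^K - 1 has K ones, while
-- xz = d + 2^K (x - 2) with d = 2^(K+1) - x complementary to x - 1 in K + 1
-- digits, and ν(x - 2) = ν(x - 1); hence ν(xz) = K + 1.
changer-3mod4 : ∀ A → ¬ IsPowerOf2 (1 + (1 + A * 2) * 2) → Σ ℕ (ParityChanger (1 + (1 + A * 2) * 2))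
changer-3mod4 A np with leading-bit (1 + (1 + A * 2) * 2) (s≤s z≤n)
... | K , zero , _ , x≡P = ⊥-elim (np (K , sym (trans x≡P (+-identityʳ (2 ^ K)))))
... | K , suc r , r<P , x≡P+r = allOnes K , m-suc (x * allOnes K) (allOnes K) ν-xz
  where
    open ≡-Reasoning
    x d : ℕ
    x = 1 + (1 + A * 2) * 2
    d = 2 ^ K ∸ suc r
    d+r : d + suc r ≡ 2 ^ K
    d+r = m∸n+n≡m (<⇒≤ r<P)
    d+x : d + x ≡ 2 * 2 ^ K
    d+x = begin
      d + x                  ≡⟨ cong (d +_) x≡P+r ⟩
      d + (2 ^ K + suc r)    ≡⟨ swap d (2 ^ K) (suc r) ⟩
      2 ^ K + (d + suc r)    ≡⟨ cong (2 ^ K +_) (trans d+r (sym (+-identityʳ (2 ^ K)))) ⟩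
      2 * 2 ^ K              ∎
      where
        swap : ∀ a b c → a + (b + c) ≡ b + (a + c)
        swap = solve-∀
    ν-xz : popcount (x * allOnes K) ≡ suc (popcount (allOnes K))
    ν-xz = begin
      popcount (x * allOnes K)                    ≡⟨ cong popcount (times-allOnes K 2 (1 + A * 2 * 2) d d+x) ⟩
      popcount (d + 2 ^ K * (1 + A * 2 * 2))      ≡⟨ popcount-concat K d _ (below-sum d+r) ⟩
      popcount d + popcount (1 + A * 2 * 2)       ≡⟨ cong (popcount d +_) same-ones ⟩
      popcount d + popcount ((1 + A * 2) * 2)     ≡⟨ +-comm (popcount d) _ ⟩
      popcount ((1 + A * 2) * 2) + popcount d     ≡⟨ popcount-complement (suc K) _ d (complement-below (suc K) _ d d+x) ⟩
      suc K                                       ≡⟨ cong suc (sym (popcount-allOnes K)) ⟩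
      suc (popcount (allOnes K))                  ∎
      where
        same-ones : popcount (1 + A * 2 * 2) ≡ popcount ((1 + A * 2) * 2)
        same-ones = trans (popcount-odd (A * 2))
                          (trans (cong suc (popcount-even A)) (sym (trans (popcount-even (1 + A * 2)) (popcount-odd A))))

changer-odd : ∀ q → ¬ IsPowerOf2 (1 + q * 2) → Σ ℕ (ParityChanger (1 + q * 2))
changer-odd q np with halving q
... | even A = changer-1mod4 A np
... | odd A  = changer-3mod4 A np

changer : ∀ x → 0 < x → ¬ IsPowerOf2 x → Σ ℕ (ParityChanger x)
changer = <-rec Goal step
  where
    Goal : ℕ → Set
    Goal x = 0 < x → ¬ IsPowerOf2 x → Σ ℕ (ParityChanger x)
    step : ∀ x → (∀ {y} → y < x → Goal y) → Goal x
    step x rec x>0 np with halving x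
    ... | odd q       = changer-odd q np
    ... | even zero   = ⊥-elim (<-irrefl refl x>0)
    ... | even (suc q) = let (z , ch) = rec half<x (s≤s z≤n) half-np in z , changer-double (suc q) z ch
      where
        half<x : suc q < suc q * 2
        half<x = s≤s (s≤s (m≤m*n q 2))
        half-np : ¬ IsPowerOf2 (suc q)
        half-np (k , 2^k≡) = np (suc k , trans (cong (2 *_) 2^k≡) (*-comm 2 (suc q)))

mainTheorem19 : (x : ℕ) → 0 < x → ¬ IsPowerOf2 x →
    Σ ℕ (λ y → 0 < y × m y ≡ 0 × m (x * y) ≡ 1)
mainTheorem19 x x>0 np = let (z , ch) = changer x x>0 np in witness-from-changer x z x>0 ch
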